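{- For $n\geq 0$, $$F_n^I(x,y,q)=\sum_{2k\leq n}\binom{n-k}{k}x^{n-2k}y^kq^{\binom{n}{2}-k}.$$
   Context: $S_n(123,132,213)$ is the set of permutations of $[n]$ with no subsequence order isomorphic to $123$, $132$ or $213$; each such $\pi$ is a concatenation of increasing blocks of size $1$ or $2$, each block larger than all later blocks. $s(\pi)$, $d(\pi)$ are the numbers of maximal increasing runs of $\pi$ of length $1$ and $2$, and $inv(\pi)$ is the number of inversions. $F_n^I(x,y,q)=\sum_{\pi\in S_n(123,132,213)}x^{s(\pi)}y^{d(\pi)}q^{inv(\pi)}$. -}

module Defs where

open import Data.Bool using (Bool; true; false; _∧_; _∨_; not; if_then_else_)
open import Data.Nat using (ℕ; zero; suc; _+_; _*_; _∸_; _<ᵇ_; _≡ᵇ_; _≤ᵇ_)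
open import Data.Nat.Combinatorics using (_C_)
open import Data.List using (List; []; _∷_; map; concatMap; length; upTo; foldr; _++_)
open import Algebra.Bundles using (CommutativeSemiring)
open import Level using (Level)

filterᵇ : {A : Set} → (A → Bool) → List A → List A
filterᵇ p [] = []
filterᵇ p (x ∷ xs) = if p x then x ∷ filterᵇ p xs else filterᵇ p xs

allᵇ : {A : Set} → (A → Bool) → List A → Bool
allᵇ p [] = true
allᵇ p (x ∷ xs) = p x ∧ allᵇ p xs

anyᵇ : {A : Set} → (A → Bool) → List A → Bool
anyᵇ p [] = false
anyᵇ p (x ∷ xs) = p x ∨ anyᵇ p xs

elem : ℕ → List ℕ → Bool
elem a bs = anyᵇ (λ b → a ≡ᵇ b) bs

count : {A : Set} → (A → Bool) → List A → ℕ
count p xs = length (filterᵇ p xs)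

words : ℕ → ℕ → List (List ℕ)
words zero    k = [] ∷ []
words (suc l) k = concatMap (λ a → map (a ∷_) (words l k)) (map suc (upTo k))

-- a word of length n over {1,…,n} containing every letter 1,…,n
-- is exactly a permutation of [n] in one-line notation
isPerm : ℕ → List ℕ → Bool
isPerm n w = allᵇ (λ a → elem (suc a) w) (upTo n)

perms : ℕ → List (List ℕ)
perms n = filterᵇ (isPerm n) (words n n)

subseqs : {A : Set} → ℕ → List A → List (List A)
subseqs zero    xs       = [] ∷ []
subseqs (suc k) []       = []
subseqs (suc k) (x ∷ xs) = map (x ∷_) (subseqs k xs) ++ subseqs (suc k) xs

zipᵇ : (ℕ → ℕ → Bool) → List ℕ → List ℕ → List Bool
zipᵇ f [] _ = []
zipᵇ f (_ ∷ _) [] = []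
zipᵇ f (a ∷ as) (b ∷ bs) = f a b ∷ zipᵇ f as bs

_⇔ᵇ_ : Bool → Bool → Bool
true  ⇔ᵇ b = b
false ⇔ᵇ b = not b

orderIso : List ℕ → List ℕ → Bool
orderIso u v =
  (length u ≡ᵇ length v) ∧
  allᵇ (λ i → allᵇ (λ j → ((at i u <ᵇ at j u) ⇔ᵇ (at i v <ᵇ at j v)))
                   (upTo (length u)))
       (upTo (length u))
  where
  at : ℕ → List ℕ → ℕ
  at _       []       = 0
  at zero    (x ∷ _)  = x
  at (suc i) (_ ∷ xs) = at i xs

contains : List ℕ → List ℕ → Bool
contains π σ = anyᵇ (λ u → orderIso u σ) (subseqs (length σ) π)

avoids : List ℕ → List ℕ → Bool
avoids π σ = not (contains π σ)

avoiders : ℕ → List (List ℕ)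
avoiders n = filterᵇ (λ π → avoids π (1 ∷ 2 ∷ 3 ∷ []) ∧
                            avoids π (1 ∷ 3 ∷ 2 ∷ []) ∧
                            avoids π (2 ∷ 1 ∷ 3 ∷ []))
                     (perms n)

runs : List ℕ → List (List ℕ)
runs [] = []
runs (x ∷ xs) = go x [] xs
  where
  -- go cur acc rest : cur is the last letter of the current run,
  -- acc the earlier letters of the current run (reversed)
  rev : List ℕ → List ℕ → List ℕ
  rev [] ys = ys
  rev (z ∷ zs) ys = rev zs (z ∷ ys)
  go : ℕ → List ℕ → List ℕ → List (List ℕ)
  go cur acc [] = rev (cur ∷ acc) [] ∷ []
  go cur acc (y ∷ ys) =
    if cur <ᵇ y then go y (cur ∷ acc) ys
                else rev (cur ∷ acc) [] ∷ go y [] ys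

sStat : List ℕ → ℕ
sStat π = count (λ r → length r ≡ᵇ 1) (runs π)

dStat : List ℕ → ℕ
dStat π = count (λ r → length r ≡ᵇ 2) (runs π)

inv : List ℕ → ℕ
inv [] = 0
inv (x ∷ xs) = count (λ y → y <ᵇ x) xs + inv xs

-- Evaluation in an arbitrary commutative semiring
-- (an identity holding for all x,y,q in every commutative semiring is
-- exactly an identity of polynomials in ℕ[x,y,q])

module Eval {c ℓ : Level} (R : CommutativeSemiring c ℓ) where
  open CommutativeSemiring R using (Carrier; 0#; 1#) renaming (_+_ to _⊕_; _*_ to _⊗_)

  pow : Carrier → ℕ → Carrier
  pow a zero    = 1#
  pow a (suc m) = a ⊗ pow a m

  times : ℕ → Carrier → Carrier
  times zero    a = 0#
  times (suc m) a = a ⊕ times m a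

  sumL : {A : Set} → (A → Carrier) → List A → Carrier
  sumL f [] = 0#
  sumL f (a ∷ as) = f a ⊕ sumL f as

  F : ℕ → Carrier → Carrier → Carrier → Carrier
  F n x y q =
    sumL (λ π → pow x (sStat π) ⊗ (pow y (dStat π) ⊗ pow q (inv π)))
         (avoiders n)

  RHS : ℕ → Carrier → Carrier → Carrier → Carrier
  RHS n x y q =
    sumL (λ k → times ((n ∸ k) C k)
                  (pow x (n ∸ 2 * k) ⊗ (pow y k ⊗ pow q ((n C 2) ∸ k))))
         (filterᵇ (λ k → 2 * k ≤ᵇ n) (upTo (suc n)))

-- A permutation avoiding 123, 132 and 213 must begin with its maximum n, or with
-- n − 1 followed by n: otherwise the first two entries form a 123 or a 213 with n, or
-- the entry before n forms a 132 with n and n − 1. Hence these permutations are exactly the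
-- layered ones, and removing the first block multiplies x^s y^d q^inv by x q^(n−1) or by
-- y q^(2(n−2)). So F_{n+2} = x q^(n+1) F_{n+1} + y q^(2n) F_n, and by Pascal's rule for
-- C(n−k, k) the closed form satisfies the same recurrence and the same initial values.

module Submission where

open import Level using (Level)
open import Function.Base using (_∘_; id)
open import Function.Bundles using (_⇔_; mk⇔; module Equivalence)
import Function.Properties.Equivalence as ⇔
open import Data.Bool.Base using (Bool; true; false; T; not; _∧_; _∨_)
open import Data.Bool.Properties using (T-∧; T-≡; T-not-≡)
open import Data.Bool.ListAction using (all; any)
open import Data.Empty using (⊥-elim)
open import Data.Product.Base using (∃; ∃₂; _×_; _,_; proj₁; proj₂)
open import Data.Sum.Base using (inj₁; inj₂)
open import Data.Nat.Base
  using (ℕ; zero; suc; _+_; _*_; _∸_; _≤_; _<_; z≤n; s≤s; _<ᵇ_; _≡ᵇ_; _≤ᵇ_)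
import Data.Nat.Properties as ℕ
open import Data.Nat.Combinatorics using (_C_; k>n⇒nCk≡0; nCk+nC[k+1]≡[n+1]C[k+1]; nC1≡n)
open import Data.Fin.Base using (Fin; toℕ; inject₁; fromℕ)
open import Data.Fin.Properties using (toℕ-inject₁; toℕ-fromℕ)
open import Data.List.Base
  using (List; []; _∷_; _++_; map; foldr; length; upTo; applyUpTo; filter; concatMap; cartesianProductWith)
open import Data.List.Properties using (length-++-sucʳ; length-map; length-upTo; ∷-injective; filter-all)
open import Data.List.Membership.Propositional using (_∈_; find; lose)
open import Data.List.Membership.Propositional.Properties
  using ( ∈-map⁺; ∈-map⁻; ∈-++⁺ˡ; ∈-++⁺ʳ; ∈-++⁻; ∈-∃++; ∈-upTo⁺; ∈-upTo⁻; ∈-filter⁺; ∈-filter⁻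
        ; ∈-cartesianProductWith⁺; ∈-cartesianProductWith⁻)
open import Data.List.Membership.Propositional.Properties.WithK using (unique∧set⇒bag)
open import Data.List.Membership.DecPropositional ℕ._≟_ using (_∈?_)
open import Data.List.Relation.Unary.All as All using (All; []; _∷_)
open import Data.List.Relation.Unary.All.Properties using (all⁺; all⁻)
open import Data.List.Relation.Unary.Any as Any using (Any; here; there)
open import Data.List.Relation.Unary.Any.Properties using (any⇔)
open import Data.List.Relation.Unary.AllPairs using ([]; _∷_)
open import Data.List.Relation.Unary.Unique.Propositional using (Unique)
import Data.List.Relation.Unary.Unique.Propositional.Properties as Unique
open import Data.List.Relation.Binary.Subset.Propositional using (_⊆_)
open import Data.List.Relation.Binary.Sublist.Propositional
  using ([]; _∷_; _∷ʳ_; minimum; from∈) renaming (_⊆_ to _⊑_)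
open import Data.List.Relation.Binary.Sublist.Propositional.Properties using (All-resp-⊆)
open import Data.List.Relation.Binary.BagAndSetEquality using (∼bag⇒↭)
open import Data.List.Relation.Binary.Permutation.Propositional using (_↭_; ↭⇒↭ₛ′)
import Data.List.Relation.Binary.Permutation.Propositional.Properties as ↭
import Data.List.Relation.Binary.Permutation.Setoid.Properties as ↭ₛ
open import Relation.Binary.Definitions using (tri<; tri≈; tri>)
open import Relation.Binary.PropositionalEquality using (_≡_; _≢_; refl; sym; trans; cong; cong₂; subst)
open import Relation.Nullary.Decidable using (T?; yes; no)
open import Relation.Nullary.Negation using (¬_; contradiction)
open import Algebra.Bundles using (CommutativeSemiring)
import Algebra.Solver.CommutativeMonoid as CommutativeMonoidSolver

open import Defs

open Equivalence using (to; from)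

private
  variable
    A B D : Set
    a b c j k n : ℕ
    xs π σ u w : List ℕ

filterᵇ≡filter : (p : A → Bool) (xs : List A) → filterᵇ p xs ≡ filter (T? ∘ p) xs
filterᵇ≡filter p [] = refl
filterᵇ≡filter p (x ∷ xs) with p x
... | true  = cong (x ∷_) (filterᵇ≡filter p xs)
... | false = filterᵇ≡filter p xs

allᵇ≡all : (p : A → Bool) (xs : List A) → allᵇ p xs ≡ all p xs
allᵇ≡all p [] = refl
allᵇ≡all p (x ∷ xs) = cong (p x ∧_) (allᵇ≡all p xs)

anyᵇ≡any : (p : A → Bool) (xs : List A) → anyᵇ p xs ≡ any p xs
anyᵇ≡any p [] = refl
anyᵇ≡any p (x ∷ xs) = cong (p x ∨_) (anyᵇ≡any p xs)

T-anyᵇ⇔ : (p : A → Bool) {xs : List A} → T (anyᵇ p xs) ⇔ Any (T ∘ p) xs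
T-anyᵇ⇔ p {xs} rewrite anyᵇ≡any p xs = ⇔.sym any⇔

elem⇔∈ : T (elem a xs) ⇔ a ∈ xs
elem⇔∈ {a} = mk⇔ (Any.map (ℕ.≡ᵇ⇒≡ a _) ∘ to (T-anyᵇ⇔ _))
                 (from (T-anyᵇ⇔ _) ∘ Any.map (ℕ.≡⇒≡ᵇ a _))

T-allᵇ⇔ : (p : A → Bool) {xs : List A} → T (allᵇ p xs) ⇔ All (T ∘ p) xs
T-allᵇ⇔ p {xs} rewrite allᵇ≡all p xs = mk⇔ (all⁺ p xs) (all⁻ p)

T-not⇔¬T : (b : Bool) → T (not b) ⇔ (¬ T b)
T-not⇔¬T true  = mk⇔ (λ ()) (λ ¬t → ¬t _)
T-not⇔¬T false = mk⇔ (λ _ ()) (λ _ → _)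

length-mono-⊆ : {xs ys : List A} → Unique xs → xs ⊆ ys → length xs ≤ length ys
length-mono-⊆ {xs = []} _ _ = z≤n
length-mono-⊆ {xs = x ∷ xs} (x≢xs ∷ xs!) xs⊆ys
  with as , bs , refl ← ∈-∃++ (xs⊆ys (here refl)) =
  subst (suc (length xs) ≤_) (sym (length-++-sucʳ as x bs))
        (s≤s (length-mono-⊆ xs! (λ z∈xs → skip (All.lookup x≢xs z∈xs) (xs⊆ys (there z∈xs)))))
  where
  skip : ∀ {z} → x ≢ z → z ∈ as ++ x ∷ bs → z ∈ as ++ bs
  skip x≢z z∈ with ∈-++⁻ as z∈
  ... | inj₁ z∈as         = ∈-++⁺ˡ z∈as
  ... | inj₂ (here z≡x)   = contradiction (sym z≡x) x≢z
  ... | inj₂ (there z∈bs) = ∈-++⁺ʳ as z∈bs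

[1…_] : ℕ → List ℕ
[1… n ] = map suc (upTo n)

∈-[1…]⇔ : a ∈ [1… n ] ⇔ (0 < a × a ≤ n)
∈-[1…]⇔ = mk⇔ to′ from′
  where
  to′ : a ∈ [1… n ] → 0 < a × a ≤ n
  to′ a∈ with _ , b∈ , refl ← ∈-map⁻ suc a∈ = s≤s z≤n , ∈-upTo⁻ b∈
  from′ : 0 < a × a ≤ n → a ∈ [1… n ]
  from′ (s≤s z≤n , a≤n) = ∈-map⁺ suc (∈-upTo⁺ a≤n)

[1…]-unique : Unique [1… n ]
[1…]-unique {n} = Unique.map⁺ ℕ.suc-injective (Unique.upTo⁺ n)

length-[1…] : length [1… n ] ≡ n
length-[1…] {n} = trans (length-map suc (upTo n)) (length-upTo n)

⊇[1…]⇒⊆[1…] : length π ≤ n → [1… n ] ⊆ π → π ⊆ [1… n ]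
⊇[1…]⇒⊆[1…] {π} {n} len≤n cover {x} x∈π with x ∈? [1… n ]
... | yes x∈ = x∈
... | no x∉ = contradiction (length-mono-⊆ x∷[1…n]-unique x∷[1…n]⊆π) too-long
  where
  x∷[1…n]-unique : Unique (x ∷ [1… n ])
  x∷[1…n]-unique = All.tabulate (λ y∈ x≡y → x∉ (subst (_∈ _) (sym x≡y) y∈)) ∷ [1…]-unique
  x∷[1…n]⊆π : x ∷ [1… n ] ⊆ π
  x∷[1…n]⊆π (here refl) = x∈π
  x∷[1…n]⊆π (there y∈)  = cover y∈
  too-long : ¬ (suc (length [1… n ]) ≤ length π)
  too-long le rewrite length-[1…] {n} = ℕ.<-irrefl refl (ℕ.<-≤-trans le len≤n)

concatMap-map≡cartesianProductWith : (f : A → B → D) (xs : List A) (ys : List B) →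
  concatMap (λ x → map (f x) ys) xs ≡ cartesianProductWith f xs ys
concatMap-map≡cartesianProductWith f [] ys = refl
concatMap-map≡cartesianProductWith f (x ∷ xs) ys =
  cong (map (f x) ys ++_) (concatMap-map≡cartesianProductWith f xs ys)

words-suc : ∀ l k → words (suc l) k ≡ cartesianProductWith _∷_ [1… k ] (words l k)
words-suc l k = concatMap-map≡cartesianProductWith _∷_ [1… k ] (words l k)

∈-words⁺ : ∀ {l k} w → length w ≡ l → All (_∈ [1… k ]) w → w ∈ words l k
∈-words⁺ [] refl [] = here refl
∈-words⁺ {suc l} {k} (x ∷ w) len (x∈ ∷ w⊆) rewrite words-suc l k =
  ∈-cartesianProductWith⁺ _∷_ x∈ (∈-words⁺ w (ℕ.suc-injective len) w⊆)

∈-words⁻ : ∀ l {k w} → w ∈ words l k → length w ≡ l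
∈-words⁻ zero (here refl) = refl
∈-words⁻ (suc l) {k} w∈ rewrite words-suc l k
  with _ , _ , _ , v∈ , refl ← ∈-cartesianProductWith⁻ _∷_ [1… k ] (words l k) w∈ =
  cong suc (∈-words⁻ l v∈)

words-unique : ∀ l k → Unique (words l k)
words-unique zero k = [] ∷ []
words-unique (suc l) k rewrite words-suc l k =
  Unique.cartesianProductWith⁺ _∷_ ∷-injective ([1…]-unique {k}) (words-unique l k)

isPerm⇔ : T (isPerm n w) ⇔ [1… n ] ⊆ w
isPerm⇔ {n} {w} = mk⇔ to′ from′
  where
  to′ : T (isPerm n w) → [1… n ] ⊆ w
  to′ t a∈ with _ , b∈ , refl ← ∈-map⁻ suc a∈ = to elem⇔∈ (All.lookup (to (T-allᵇ⇔ _) t) b∈)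
  from′ : [1… n ] ⊆ w → T (isPerm n w)
  from′ cover = from (T-allᵇ⇔ _) (All.tabulate (λ b∈ → from elem⇔∈ (cover (∈-map⁺ suc b∈))))

∈-subseqs⁻ : ∀ k xs → u ∈ subseqs k xs → u ⊑ xs
∈-subseqs⁻ zero xs (here refl) = minimum xs
∈-subseqs⁻ (suc k) (x ∷ xs) u∈ with ∈-++⁻ (map (x ∷_) (subseqs k xs)) u∈
... | inj₁ u∈₁ with _ , v∈ , refl ← ∈-map⁻ (x ∷_) u∈₁ = refl ∷ ∈-subseqs⁻ k xs v∈
... | inj₂ u∈₂ = x ∷ʳ ∈-subseqs⁻ (suc k) xs u∈₂

∈-subseqs⁺ : u ⊑ xs → u ∈ subseqs (length u) xs
∈-subseqs⁺ []                 = here refl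
∈-subseqs⁺ {[]}    (y ∷ʳ u⊑)  = here refl
∈-subseqs⁺ {_ ∷ _} (y ∷ʳ u⊑)  = ∈-++⁺ʳ _ (∈-subseqs⁺ u⊑)
∈-subseqs⁺ (refl ∷ u⊑)        = ∈-++⁺ˡ (∈-map⁺ _ (∈-subseqs⁺ u⊑))

orderIso⇒length≡ : ∀ u σ → T (orderIso u σ) → length u ≡ length σ
orderIso⇒length≡ u σ iso = ℕ.≡ᵇ⇒≡ (length u) (length σ) (proj₁ (to T-∧ iso))

Contains : List ℕ → List ℕ → Set
Contains π σ = ∃ λ u → u ⊑ π × T (orderIso u σ)

T-contains⇔ : T (contains π σ) ⇔ Contains π σ
T-contains⇔ {π} {σ} = mk⇔ to′ from′
  where
  to′ : T (contains π σ) → Contains π σ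
  to′ t with u , u∈ , iso ← find (to (T-anyᵇ⇔ (λ v → orderIso v σ)) t) =
    u , ∈-subseqs⁻ (length σ) π u∈ , iso
  from′ : Contains π σ → T (contains π σ)
  from′ (u , u⊑ , iso) =
    from (T-anyᵇ⇔ (λ v → orderIso v σ))
         (lose (subst (λ k → u ∈ subseqs k π) (orderIso⇒length≡ u σ iso) (∈-subseqs⁺ u⊑)) iso)

σ123 σ132 σ213 : List ℕ
σ123 = 1 ∷ 2 ∷ 3 ∷ []
σ132 = 1 ∷ 3 ∷ 2 ∷ []
σ213 = 2 ∷ 1 ∷ 3 ∷ []

patterns : List (List ℕ)
patterns = σ123 ∷ σ132 ∷ σ213 ∷ []

Avoids : List ℕ → Set
Avoids π = ∀ {σ} → σ ∈ patterns → ¬ Contains π σ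

avoidsPatternsᵇ : List ℕ → Bool
avoidsPatternsᵇ π = avoids π σ123 ∧ avoids π σ132 ∧ avoids π σ213

T-avoidsPatterns⇔ : T (avoidsPatternsᵇ π) ⇔ Avoids π
T-avoidsPatterns⇔ {π} = mk⇔ to′ from′
  where
  avoids⇔ : ∀ {σ} → T (avoids π σ) ⇔ (¬ Contains π σ)
  avoids⇔ {σ} = mk⇔ (λ t → to (T-not⇔¬T _) t ∘ from (T-contains⇔ {π} {σ}))
                      (λ ¬c → from (T-not⇔¬T _) (¬c ∘ to (T-contains⇔ {π} {σ})))
  to′ : T (avoidsPatternsᵇ π) → Avoids π
  to′ t σ∈ with t₁ , t₂₃ ← to (T-∧ {avoids π σ123}) t
             with t₂ , t₃ ← to (T-∧ {avoids π σ132}) t₂₃ with σ∈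
  ... | here refl                 = to avoids⇔ t₁
  ... | there (here refl)         = to avoids⇔ t₂
  ... | there (there (here refl)) = to avoids⇔ t₃
  from′ : Avoids π → T (avoidsPatternsᵇ π)
  from′ av = from T-∧ ( from avoids⇔ (av (here refl))
                      , from T-∧ ( from avoids⇔ (av (there (here refl)))
                                 , from avoids⇔ (av (there (there (here refl))))))

avoids-tail : Avoids (a ∷ π) → Avoids π
avoids-tail av σ∈ (u , u⊑ , iso) = av σ∈ (u , _ ∷ʳ u⊑ , iso)

avoids-∷ : (∀ {σ u} → σ ∈ patterns → u ⊑ π → ¬ T (orderIso (a ∷ u) σ)) →
           Avoids π → Avoids (a ∷ π)
avoids-∷ headFree av σ∈ (_ , _ ∷ʳ u⊑ , iso) = av σ∈ (_ , u⊑ , iso)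
avoids-∷ headFree av σ∈ (_ , refl ∷ u⊑ , iso) = headFree σ∈ u⊑ iso

<ᵇ-true : ∀ {m n} → m < n → (m <ᵇ n) ≡ true
<ᵇ-true a<b = to T-≡ (ℕ.<⇒<ᵇ a<b)

<ᵇ-false : ∀ {m n} → n ≤ m → (m <ᵇ n) ≡ false
<ᵇ-false {m} {n} n≤m = to T-not-≡ (from (T-not⇔¬T _) (ℕ.≤⇒≯ n≤m ∘ ℕ.<ᵇ⇒< m n))

¬orderIso-maxFirst : b < a → c < a → All (λ σ → ¬ T (orderIso (a ∷ b ∷ c ∷ []) σ)) patterns
¬orderIso-maxFirst {b} {a} {c} b<a c<a
  rewrite <ᵇ-false {a} ℕ.≤-refl | <ᵇ-false (ℕ.<⇒≤ b<a) | <ᵇ-false (ℕ.<⇒≤ c<a) =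
  (λ ()) ∷ (λ ()) ∷ (λ ()) ∷ []

¬orderIso-231 : a < b → c < a → All (λ σ → ¬ T (orderIso (a ∷ b ∷ c ∷ []) σ)) patterns
¬orderIso-231 {a} {b} {c} a<b c<a
  rewrite <ᵇ-false {a} ℕ.≤-refl | <ᵇ-true a<b | <ᵇ-false (ℕ.<⇒≤ c<a) =
  (λ ()) ∷ (λ ()) ∷ (λ ()) ∷ []

orderIso-123 : a < b → b < c → T (orderIso (a ∷ b ∷ c ∷ []) σ123)
orderIso-123 {a} {b} {c} a<b b<c
  rewrite <ᵇ-false {a} ℕ.≤-refl | <ᵇ-false {b} ℕ.≤-refl | <ᵇ-false {c} ℕ.≤-refl
        | <ᵇ-true a<b | <ᵇ-true b<c | <ᵇ-true (ℕ.<-trans a<b b<c)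
        | <ᵇ-false (ℕ.<⇒≤ a<b) | <ᵇ-false (ℕ.<⇒≤ b<c) | <ᵇ-false (ℕ.<⇒≤ (ℕ.<-trans a<b b<c)) = _

orderIso-132 : a < c → c < b → T (orderIso (a ∷ b ∷ c ∷ []) σ132)
orderIso-132 {a} {c} {b} a<c c<b
  rewrite <ᵇ-false {a} ℕ.≤-refl | <ᵇ-false {b} ℕ.≤-refl | <ᵇ-false {c} ℕ.≤-refl
        | <ᵇ-true a<c | <ᵇ-true c<b | <ᵇ-true (ℕ.<-trans a<c c<b)
        | <ᵇ-false (ℕ.<⇒≤ a<c) | <ᵇ-false (ℕ.<⇒≤ c<b) | <ᵇ-false (ℕ.<⇒≤ (ℕ.<-trans a<c c<b)) = _

orderIso-213 : b < a → a < c → T (orderIso (a ∷ b ∷ c ∷ []) σ213)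
orderIso-213 {b} {a} {c} b<a a<c
  rewrite <ᵇ-false {a} ℕ.≤-refl | <ᵇ-false {b} ℕ.≤-refl | <ᵇ-false {c} ℕ.≤-refl
        | <ᵇ-true b<a | <ᵇ-true a<c | <ᵇ-true (ℕ.<-trans b<a a<c)
        | <ᵇ-false (ℕ.<⇒≤ b<a) | <ᵇ-false (ℕ.<⇒≤ a<c) | <ᵇ-false (ℕ.<⇒≤ (ℕ.<-trans b<a a<c)) = _

pattern-length : σ ∈ patterns → length σ ≡ 3
pattern-length (here refl)                 = refl
pattern-length (there (here refl))         = refl
pattern-length (there (there (here refl))) = refl

occurrence-shape : σ ∈ patterns → T (orderIso (a ∷ u) σ) → ∃₂ λ b c → u ≡ b ∷ c ∷ []
occurrence-shape {σ} {a} {u} σ∈ iso with u | trans (orderIso⇒length≡ (a ∷ u) σ iso) (pattern-length σ∈)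
... | b ∷ c ∷ [] | _ = b , c , refl

avoids-[] : Avoids []
avoids-[] {σ} σ∈ (_ , [] , iso) = ℕ.0≢1+n (trans (orderIso⇒length≡ [] σ iso) (pattern-length σ∈))

avoids-max∷ : All (_< a) π → Avoids π → Avoids (a ∷ π)
avoids-max∷ {a} {π} π<a = avoids-∷ headFree
  where
  headFree : ∀ {σ u} → σ ∈ patterns → u ⊑ π → ¬ T (orderIso (a ∷ u) σ)
  headFree {u = u} σ∈ u⊑π iso with occurrence-shape {a = a} {u = u} σ∈ iso
  ... | _ , _ , refl with b<a ∷ c<a ∷ [] ← All-resp-⊆ u⊑π π<a =
    All.lookup (¬orderIso-maxFirst b<a c<a) σ∈ iso

avoids-block∷ : a < b → All (_< a) π → Avoids π → Avoids (a ∷ b ∷ π)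
avoids-block∷ {a} {b} {π} a<b π<a av =
  avoids-∷ headFree (avoids-max∷ (All.map (λ c<a → ℕ.<-trans c<a a<b) π<a) av)
  where
  headFree : ∀ {σ u} → σ ∈ patterns → u ⊑ b ∷ π → ¬ T (orderIso (a ∷ u) σ)
  headFree {u = u} σ∈ u⊑ iso with occurrence-shape {a = a} {u = u} σ∈ iso
  headFree σ∈ (_ ∷ʳ u⊑π) iso | _ , _ , refl with d<a ∷ e<a ∷ [] ← All-resp-⊆ u⊑π π<a =
    All.lookup (¬orderIso-maxFirst d<a e<a) σ∈ iso
  headFree σ∈ (refl ∷ e⊑π) iso | _ , _ , refl with e<a ∷ [] ← All-resp-⊆ e⊑π π<a =
    All.lookup (¬orderIso-231 a<b e<a) σ∈ iso

record Avoider (n : ℕ) (π : List ℕ) : Set where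
  field
    length≡  : length π ≡ n
    covers   : [1… n ] ⊆ π
    avoiding : Avoids π

  entries≤ : All (_≤ n) π
  entries≤ = All.tabulate (proj₂ ∘ to ∈-[1…]⇔ ∘ ⊇[1…]⇒⊆[1…] (ℕ.≤-reflexive length≡) covers)

open Avoider

avoiders≡filter : ∀ n → avoiders n ≡ filter (T? ∘ avoidsPatternsᵇ) (filter (T? ∘ isPerm n) (words n n))
avoiders≡filter n
  rewrite filterᵇ≡filter avoidsPatternsᵇ (perms n) | filterᵇ≡filter (isPerm n) (words n n) = refl

∈-avoiders⇔ : π ∈ avoiders n ⇔ Avoider n π
∈-avoiders⇔ {π} {n} rewrite avoiders≡filter n = mk⇔ to′ from′
  where
  to′ : π ∈ filter (T? ∘ avoidsPatternsᵇ) (filter (T? ∘ isPerm n) (words n n)) → Avoider n π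
  to′ π∈ with π∈perms , av   ← ∈-filter⁻ (T? ∘ avoidsPatternsᵇ) π∈
         with π∈words , perm ← ∈-filter⁻ (T? ∘ isPerm n) π∈perms =
    record { length≡  = ∈-words⁻ n π∈words
           ; covers   = to isPerm⇔ perm
           ; avoiding = to T-avoidsPatterns⇔ av
           }
  from′ : Avoider n π → π ∈ filter (T? ∘ avoidsPatternsᵇ) (filter (T? ∘ isPerm n) (words n n))
  from′ av =
    ∈-filter⁺ (T? ∘ avoidsPatternsᵇ)
      (∈-filter⁺ (T? ∘ isPerm n)
        (∈-words⁺ π (length≡ av)
          (All.tabulate (⊇[1…]⇒⊆[1…] (ℕ.≤-reflexive (length≡ av)) (covers av))))
        (from isPerm⇔ (covers av)))
      (from T-avoidsPatterns⇔ (avoiding av))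

avoiders-unique : ∀ n → Unique (avoiders n)
avoiders-unique n rewrite avoiders≡filter n =
  Unique.filter⁺ _ (Unique.filter⁺ _ (words-unique n n))

-- The permutations whose one-line notation is a concatenation of increasing blocks of
-- size 1 or 2, each larger than all later ones, listed according to their first block.
layered : ℕ → List (List ℕ)
layered 0             = [] ∷ []
layered 1             = (1 ∷ []) ∷ []
layered (suc (suc n)) = map (suc (suc n) ∷_) (layered (suc n))
                     ++ map (λ π → suc n ∷ suc (suc n) ∷ π) (layered n)

layered-unique : ∀ n → Unique (layered n)
layered-unique 0             = [] ∷ []
layered-unique 1             = [] ∷ []
layered-unique (suc (suc n)) =
  Unique.++⁺ (Unique.map⁺ (proj₂ ∘ ∷-injective) (layered-unique (suc n)))
             (Unique.map⁺ (proj₂ ∘ ∷-injective ∘ proj₂ ∘ ∷-injective) (layered-unique n))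
             heads-differ
  where
  heads-differ : ∀ {π} → ¬ (π ∈ map (suc (suc n) ∷_) (layered (suc n))
                         × π ∈ map (λ π → suc n ∷ suc (suc n) ∷ π) (layered n))
  heads-differ (π∈₁ , π∈₂) with _ , _ , refl ← ∈-map⁻ _ π∈₁ with _ , _ , eq ← ∈-map⁻ _ π∈₂ =
    ℕ.1+n≢n (proj₁ (∷-injective eq))

covers-∷ : [1… n ] ⊆ π → [1… suc n ] ⊆ suc n ∷ π
covers-∷ {n} cover {a} a∈ with 0<a , a≤1+n ← to ∈-[1…]⇔ a∈ with a ℕ.≟ suc n
... | yes refl = here refl
... | no a≢1+n = there (cover (from ∈-[1…]⇔ (0<a , ℕ.≤-pred (ℕ.≤∧≢⇒< a≤1+n a≢1+n))))

covers-∷⁻ : n < a → [1… n ] ⊆ a ∷ π → [1… n ] ⊆ π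
covers-∷⁻ n<a cover b∈ with cover b∈
... | here refl = contradiction (proj₂ (to ∈-[1…]⇔ b∈)) (ℕ.<⇒≱ n<a)
... | there b∈π = b∈π

layered⇒avoider : ∀ n → π ∈ layered n → Avoider n π
layered⇒avoider 0 (here refl) = record { length≡ = refl ; covers = λ () ; avoiding = avoids-[] }
layered⇒avoider 1 (here refl) = record
  { length≡ = refl ; covers = covers-∷ {0} λ () ; avoiding = avoids-max∷ [] avoids-[] }
layered⇒avoider (suc (suc n)) π∈ with ∈-++⁻ (map (suc (suc n) ∷_) (layered (suc n))) π∈
... | inj₁ π∈₁ with τ , τ∈ , refl ← ∈-map⁻ _ π∈₁ =
  let τ-av = layered⇒avoider (suc n) τ∈ in record
  { length≡  = cong suc (length≡ τ-av)
  ; covers   = covers-∷ (covers τ-av)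
  ; avoiding = avoids-max∷ (All.map s≤s (entries≤ τ-av)) (avoiding τ-av)
  }
... | inj₂ π∈₂ with τ , τ∈ , refl ← ∈-map⁻ _ π∈₂ =
  let τ-av = layered⇒avoider n τ∈ in record
  { length≡  = cong (suc ∘ suc) (length≡ τ-av)
  ; covers   = swap ∘ covers-∷ (covers-∷ (covers τ-av))
  ; avoiding = avoids-block∷ ℕ.≤-refl (All.map s≤s (entries≤ τ-av)) (avoiding τ-av)
  }
  where
  swap : ∀ {a b c : ℕ} {ρ} → a ∈ b ∷ c ∷ ρ → a ∈ c ∷ b ∷ ρ
  swap (here eq)         = there (here eq)
  swap (there (here eq)) = here eq
  swap (there (there p)) = there (there p)

[1…]-⊆-suc : [1… n ] ⊆ [1… suc n ]
[1…]-⊆-suc a∈ with 0<a , a≤n ← to ∈-[1…]⇔ a∈ = from ∈-[1…]⇔ (0<a , ℕ.m≤n⇒m≤1+n a≤n)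

avoider-max∷⁻ : Avoider (suc n) (suc n ∷ π) → Avoider n π
avoider-max∷⁻ av = record
  { length≡  = ℕ.suc-injective (length≡ av)
  ; covers   = covers-∷⁻ ℕ.≤-refl (covers av ∘ [1…]-⊆-suc)
  ; avoiding = avoids-tail (avoiding av)
  }

avoider-block∷⁻ : Avoider (suc (suc n)) (suc n ∷ suc (suc n) ∷ π) → Avoider n π
avoider-block∷⁻ av = record
  { length≡  = ℕ.suc-injective (ℕ.suc-injective (length≡ av))
  ; covers   = covers-∷⁻ (ℕ.m<n⇒m<1+n ℕ.≤-refl)
                 (covers-∷⁻ ℕ.≤-refl (covers av ∘ [1…]-⊆-suc ∘ [1…]-⊆-suc))
  ; avoiding = avoids-tail (avoids-tail (avoiding av))
  }

maximum-in-first-block : Avoider (suc (suc n)) (a ∷ b ∷ π) → a ≢ suc (suc n) → b ≡ suc (suc n)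
maximum-in-first-block {n} {a} {b} {π} av a≢N with b ℕ.≟ suc (suc n)
... | yes b≡N = b≡N
... | no b≢N with a≤N ∷ b≤N ∷ _ ← entries≤ av
             with covers av (from ∈-[1…]⇔ (s≤s z≤n , ℕ.≤-refl))
... | here N≡a         = contradiction (sym N≡a) a≢N
... | there (here N≡b) = contradiction (sym N≡b) b≢N
... | there (there N∈π) with ℕ.<-cmp a b
...   | tri< a<b _ _ =
  ⊥-elim (avoiding av (here refl)
    (_ , refl ∷ refl ∷ from∈ N∈π , orderIso-123 a<b (ℕ.≤∧≢⇒< b≤N b≢N)))
...   | tri> _ _ b<a =
  ⊥-elim (avoiding av (there (there (here refl)))
    (_ , refl ∷ refl ∷ from∈ N∈π , orderIso-213 b<a (ℕ.≤∧≢⇒< a≤N a≢N)))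
...   | tri≈ _ refl _ = ⊥-elim (ℕ.1+n≰n (begin
  suc (suc n)              ≡⟨ length-[1…] ⟨
  length [1… suc (suc n) ] ≤⟨ length-mono-⊆ [1…]-unique (drop-duplicate ∘ covers av) ⟩
  length (a ∷ π)           ≡⟨ ℕ.suc-injective (length≡ av) ⟩
  suc n                    ∎))
  where
  open ℕ.≤-Reasoning
  drop-duplicate : ∀ {c} → c ∈ a ∷ a ∷ π → c ∈ a ∷ π
  drop-duplicate (here c≡a) = here c≡a
  drop-duplicate (there c∈) = c∈

entry-before-maximum : Avoider (suc (suc n)) (a ∷ suc (suc n) ∷ π) → a ≢ suc (suc n) → a ≡ suc n
entry-before-maximum {n} {a} av a≢N with a ℕ.≟ suc n
... | yes a≡1+n = a≡1+n
... | no a≢1+n with a≤N ∷ _ ← entries≤ av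
               with covers av (from ∈-[1…]⇔ (s≤s z≤n , ℕ.n≤1+n _))
... | here 1+n≡a         = contradiction (sym 1+n≡a) a≢1+n
... | there (here 1+n≡N) = contradiction 1+n≡N (ℕ.1+n≢n ∘ sym)
... | there (there 1+n∈π) =
  ⊥-elim (avoiding av (there (here refl))
    (_ , refl ∷ refl ∷ from∈ 1+n∈π , orderIso-132 a<1+n ℕ.≤-refl))
  where a<1+n = ℕ.≤∧≢⇒< (ℕ.≤-pred (ℕ.≤∧≢⇒< a≤N a≢N)) a≢1+n

avoider⇒layered-step : Avoider (suc (suc n)) (a ∷ b ∷ π) →
  (Avoider (suc n) (b ∷ π) → b ∷ π ∈ layered (suc n)) → (Avoider n π → π ∈ layered n) →
  a ∷ b ∷ π ∈ layered (suc (suc n))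
avoider⇒layered-step {n} {a} av ih₁ ih₀ with a ℕ.≟ suc (suc n)
... | yes refl = ∈-++⁺ˡ (∈-map⁺ _ (ih₁ (avoider-max∷⁻ av)))
... | no a≢N with refl ← maximum-in-first-block av a≢N with refl ← entry-before-maximum av a≢N =
  ∈-++⁺ʳ _ (∈-map⁺ _ (ih₀ (avoider-block∷⁻ av)))

avoider⇒layered : ∀ n π → Avoider n π → π ∈ layered n
avoider⇒layered 0 [] _ = here refl
avoider⇒layered 1 (a ∷ []) av with here refl ← covers av (here refl) = here refl
avoider⇒layered (suc (suc n)) (a ∷ b ∷ π) av =
  avoider⇒layered-step av (avoider⇒layered (suc n) (b ∷ π)) (avoider⇒layered n π)
avoider⇒layered 0             (_ ∷ _)     av with () ← length≡ av
avoider⇒layered 1             []          av with () ← length≡ av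
avoider⇒layered 1             (_ ∷ _ ∷ _) av with () ← length≡ av
avoider⇒layered (suc (suc n)) []          av with () ← length≡ av
avoider⇒layered (suc (suc n)) (_ ∷ [])    av with () ← length≡ av

∈-layered⇔ : π ∈ layered n ⇔ Avoider n π
∈-layered⇔ {π} {n} = mk⇔ (layered⇒avoider n) (avoider⇒layered n π)

avoiders↭layered : ∀ n → avoiders n ↭ layered n
avoiders↭layered n = ∼bag⇒↭ (unique∧set⇒bag (avoiders-unique n) (layered-unique n)
                                            (⇔.trans (∈-avoiders⇔ {n = n}) (⇔.sym ∈-layered⇔)))

runs-max∷ : All (_< a) π → runs (a ∷ π) ≡ (a ∷ []) ∷ runs π
runs-max∷ [] = refl
runs-max∷ {a} (b<a ∷ _) rewrite <ᵇ-false {a} (ℕ.<⇒≤ b<a) = refl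

runs-block∷ : a < b → All (_< b) π → runs (a ∷ b ∷ π) ≡ (a ∷ b ∷ []) ∷ runs π
runs-block∷ a<b [] rewrite <ᵇ-true a<b = refl
runs-block∷ {b = b} a<b (c<b ∷ _) rewrite <ᵇ-true a<b | <ᵇ-false {b} (ℕ.<⇒≤ c<b) = refl

count-below : All (_< a) π → count (_<ᵇ a) π ≡ length π
count-below {a} {π} π<a =
  cong length (trans (filterᵇ≡filter (_<ᵇ a) π) (filter-all (T? ∘ (_<ᵇ a)) (All.map ℕ.<⇒<ᵇ π<a)))

inv-max∷ : All (_< a) π → inv (a ∷ π) ≡ length π + inv π
inv-max∷ π<a = cong (_+ _) (count-below π<a)

inv-block∷ : a < b → All (_< a) π → inv (a ∷ b ∷ π) ≡ length π + (length π + inv π)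
inv-block∷ {a} {b} a<b π<a rewrite <ᵇ-false {b} {a} (ℕ.<⇒≤ a<b) =
  cong₂ _+_ (count-below π<a) (inv-max∷ (All.map (λ c<a → ℕ.<-trans c<a a<b) π<a))

2*≡+ : ∀ k → 2 * k ≡ k + k
2*≡+ k = cong (k +_) (ℕ.+-identityʳ k)

C2-suc : ∀ n → suc n C 2 ≡ n + n C 2
C2-suc n = trans (sym (nCk+nC[k+1]≡[n+1]C[k+1] n 1)) (cong (_+ n C 2) (nC1≡n n))

half≤C2 : 2 * k ≤ n → k ≤ n C 2
half≤C2 {zero}  _ = z≤n
half≤C2 {suc k} {suc n} 2k≤n = begin
  suc k        ≤⟨ ℕ.m≤n+m (suc k) k ⟩
  k + suc k    ≤⟨ ℕ.≤-pred (subst (_≤ suc n) (2*≡+ (suc k)) 2k≤n) ⟩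
  n            ≤⟨ ℕ.m≤m+n n (n C 2) ⟩
  n + n C 2    ≡⟨ C2-suc n ⟨
  suc n C 2    ∎
  where open ℕ.≤-Reasoning

binomial-vanishes : n < 2 * k → (n ∸ k) C k ≡ 0
binomial-vanishes {n} {suc k} n<2k =
  k>n⇒nCk≡0 (ℕ.m<n+o⇒m∸n<o n (suc k) (subst (n <_) (2*≡+ (suc k)) n<2k))

binomial-positive⇒ : 0 < (n ∸ k) C k → 2 * k ≤ n
binomial-positive⇒ {n} {k} pos with 2 * k ℕ.≤? n
... | yes 2k≤n = 2k≤n
... | no 2k≰n = ⊥-elim (ℕ.n≮0 (subst (0 <_) (binomial-vanishes {n} {k} (ℕ.≰⇒> 2k≰n)) pos))

binomial-pascal : ∀ n k → (suc n ∸ k) C suc k ≡ (n ∸ k) C k + (n ∸ k) C suc k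
binomial-pascal n zero = sym (nCk+nC[k+1]≡[n+1]C[k+1] n 0)
binomial-pascal n (suc k) with suc k ℕ.≤? n
... | yes k<n rewrite ℕ.+-∸-assoc 1 k<n = sym (nCk+nC[k+1]≡[n+1]C[k+1] (n ∸ suc k) (suc k))
... | no k≮n with n<1+k ← ℕ.≰⇒> k≮n
  rewrite ℕ.m≤n⇒m∸n≡0 n<1+k | ℕ.m≤n⇒m∸n≡0 (ℕ.<⇒≤ n<1+k) = refl

x-exponent-X : 2 * j ≤ suc n → suc (suc n) ∸ 2 * j ≡ suc (suc n ∸ 2 * j)
x-exponent-X = ℕ.+-∸-assoc 1

q-exponent-X : 2 * j ≤ suc n → suc (suc n) C 2 ∸ j ≡ suc n + (suc n C 2 ∸ j)
q-exponent-X {j} {n} 2j≤1+n =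
  trans (cong (_∸ j) (C2-suc (suc n))) (ℕ.+-∸-assoc (suc n) (half≤C2 {j} 2j≤1+n))

x-exponent-Y : ∀ n k → suc (suc n) ∸ 2 * suc k ≡ n ∸ 2 * k
x-exponent-Y n k = cong (suc n ∸_) (ℕ.+-suc k (k + 0))

q-exponent-Y : 2 * k ≤ n → suc (suc n) C 2 ∸ suc k ≡ (n + n) + (n C 2 ∸ k)
q-exponent-Y {k} {n} 2k≤n rewrite C2-suc (suc n) | C2-suc n | sym (ℕ.+-assoc n n (n C 2)) =
  ℕ.+-∸-assoc (n + n) (half≤C2 {k} 2k≤n)

module _ {c ℓ : Level} (R : CommutativeSemiring c ℓ) where

  open CommutativeSemiring R
    using ( Carrier; 0#; _≈_; setoid; isEquivalence; semiring; +-isCommutativeMonoid; *-commutativeMonoid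
          ; +-cong; +-congˡ; +-congʳ; *-congˡ; *-congʳ; +-assoc; +-comm; +-identityˡ; +-identityʳ; zeroʳ
          ; distribˡ)
    renaming ( _+_ to _⊕_; _*_ to _⊗_
             ; refl to ≈-refl; sym to ≈-sym; trans to ≈-trans; reflexive to ≈-reflexive)
  open Eval R
  open import Algebra.Properties.Semiring.Sum semiring
    using (sum-syntax; sum-cong-≋; sum-cong-≗; sum-init-last; ∑-distrib-+; *-distribˡ-sum)
  open import Algebra.Properties.Semiring.Mult semiring using (×-congʳ; ×-homo-+; ×-comm-*)
  open import Algebra.Properties.Semiring.Exp semiring using (^-homo-*)
  open import Algebra.Definitions.RawSemiring (CommutativeSemiring.rawSemiring R) using (_^_) renaming (_×_ to _·_)
  open import Relation.Binary.Reasoning.Setoid setoid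

  pow≡^ : ∀ z n → pow z n ≡ z ^ n
  pow≡^ z zero    = refl
  pow≡^ z (suc n) = cong (z ⊗_) (pow≡^ z n)

  times≡· : ∀ n z → times n z ≡ n · z
  times≡· zero    z = refl
  times≡· (suc n) z = cong (z ⊕_) (times≡· n z)

  pow-+ : ∀ z m n → pow z (m + n) ≈ pow z m ⊗ pow z n
  pow-+ z m n rewrite pow≡^ z (m + n) | pow≡^ z m | pow≡^ z n = ^-homo-* z m n

  times-+ : ∀ m n z → times (m + n) z ≈ times m z ⊕ times n z
  times-+ m n z rewrite times≡· (m + n) z | times≡· m z | times≡· n z = ×-homo-+ z m n

  times-⊗ : ∀ n z w → times n (z ⊗ w) ≈ z ⊗ times n w
  times-⊗ n z w rewrite times≡· n (z ⊗ w) | times≡· n w = ≈-sym (×-comm-* n z w)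

  times-cong-positive : ∀ n {z w} → (0 < n → z ≈ w) → times n z ≈ times n w
  times-cong-positive zero    _ = ≈-refl
  times-cong-positive (suc n) {z} {w} z≈w rewrite times≡· (suc n) z | times≡· (suc n) w =
    ×-congʳ (suc n) (z≈w (s≤s z≤n))

  sumL-++ : ∀ (f : A → Carrier) xs ys → sumL f (xs ++ ys) ≈ sumL f xs ⊕ sumL f ys
  sumL-++ f []       ys = ≈-sym (+-identityˡ _)
  sumL-++ f (x ∷ xs) ys = ≈-trans (+-congˡ (sumL-++ f xs ys)) (≈-sym (+-assoc _ _ _))

  sumL-map : ∀ (f : B → Carrier) (g : A → B) xs → sumL f (map g xs) ≡ sumL (f ∘ g) xs
  sumL-map f g []       = refl
  sumL-map f g (x ∷ xs) = cong (f (g x) ⊕_) (sumL-map f g xs)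

  sumL-cong : ∀ {f g : A → Carrier} xs → (∀ {x} → x ∈ xs → f x ≈ g x) → sumL f xs ≈ sumL g xs
  sumL-cong []       _   = ≈-refl
  sumL-cong (x ∷ xs) f≈g = +-cong (f≈g (here refl)) (sumL-cong xs (f≈g ∘ there))

  sumL-⊗ : ∀ z (f : A → Carrier) xs → sumL (λ x → z ⊗ f x) xs ≈ z ⊗ sumL f xs
  sumL-⊗ z f []       = ≈-sym (zeroʳ z)
  sumL-⊗ z f (x ∷ xs) = ≈-trans (+-congˡ (sumL-⊗ z f xs)) (≈-sym (distribˡ z _ _))

  sumL-filter : ∀ (f : A → Carrier) p xs → (∀ x → p x ≡ false → f x ≈ 0#) →
                sumL f (filterᵇ p xs) ≈ sumL f xs
  sumL-filter f p []       _ = ≈-refl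
  sumL-filter f p (x ∷ xs) f≈0 with p x in px
  ... | true  = +-congˡ (sumL-filter f p xs f≈0)
  ... | false = begin
    sumL f (filterᵇ p xs) ≈⟨ sumL-filter f p xs f≈0 ⟩
    sumL f xs             ≈⟨ +-identityˡ _ ⟨
    0# ⊕ sumL f xs        ≈⟨ +-congʳ (f≈0 x px) ⟨
    f x ⊕ sumL f xs       ∎

  sumL≡foldr : ∀ (f : A → Carrier) xs → sumL f xs ≡ foldr _⊕_ 0# (map f xs)
  sumL≡foldr f []       = refl
  sumL≡foldr f (x ∷ xs) = cong (f x ⊕_) (sumL≡foldr f xs)

  sumL-↭ : ∀ (f : A → Carrier) {xs ys} → xs ↭ ys → sumL f xs ≈ sumL f ys
  sumL-↭ f {xs} {ys} xs↭ys = begin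
    sumL f xs               ≡⟨ sumL≡foldr f xs ⟩
    foldr _⊕_ 0# (map f xs) ≈⟨ ↭ₛ.foldr-commMonoid setoid +-isCommutativeMonoid
                                 (↭⇒↭ₛ′ isEquivalence (↭.map⁺ f xs↭ys)) ⟩
    foldr _⊕_ 0# (map f ys) ≡⟨ sumL≡foldr f ys ⟨
    sumL f ys               ∎

  sumL-upTo : ∀ (f : ℕ → Carrier) n → sumL f (upTo n) ≡ ∑[ i < n ] f (toℕ i)
  sumL-upTo f n = go id n
    where
    go : ∀ g n → sumL f (applyUpTo g n) ≡ ∑[ i < n ] f (g (toℕ i))
    go g zero    = refl
    go g (suc n) = cong (f (g 0) ⊕_) (go (g ∘ suc) n)

  ∑-init : ∀ (f : ℕ → Carrier) n → f n ≈ 0# → ∑[ i < suc n ] f (toℕ i) ≈ ∑[ i < n ] f (toℕ i)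
  ∑-init f n fn≈0 = begin
    ∑[ i < suc n ] f (toℕ i)                           ≈⟨ sum-init-last {n} (f ∘ toℕ) ⟩
    ∑[ i < n ] f (toℕ (inject₁ i)) ⊕ f (toℕ (fromℕ n))
      ≡⟨ cong₂ _⊕_ (sum-cong-≗ {n} (cong f ∘ toℕ-inject₁)) (cong f (toℕ-fromℕ n)) ⟩
    ∑[ i < n ] f (toℕ i) ⊕ f n                         ≈⟨ +-congˡ fn≈0 ⟩
    ∑[ i < n ] f (toℕ i) ⊕ 0#                          ≈⟨ +-identityʳ _ ⟩
    ∑[ i < n ] f (toℕ i)                               ∎

  recurrence-unique : ∀ (X Y u v : ℕ → Carrier) → u 0 ≈ v 0 → u 1 ≈ v 1 →
    (∀ n → u (suc (suc n)) ≈ X n ⊗ u (suc n) ⊕ Y n ⊗ u n) →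
    (∀ n → v (suc (suc n)) ≈ X n ⊗ v (suc n) ⊕ Y n ⊗ v n) →
    ∀ n → u n ≈ v n
  recurrence-unique X Y u v u₀ u₁ u-rec v-rec = go
    where
    go : ∀ n → u n ≈ v n
    go 0             = u₀
    go 1             = u₁
    go (suc (suc n)) = begin
      u (suc (suc n))             ≈⟨ u-rec n ⟩
      X n ⊗ u (suc n) ⊕ Y n ⊗ u n ≈⟨ +-cong (*-congˡ (go (suc n))) (*-congˡ (go n)) ⟩
      X n ⊗ v (suc n) ⊕ Y n ⊗ v n ≈⟨ v-rec n ⟨
      v (suc (suc n))             ∎

  module _ (x y q : Carrier) where

    monomial : ℕ → ℕ → ℕ → Carrier
    monomial i j e = pow x i ⊗ (pow y j ⊗ pow q e)

    module ⊗-Solver = CommutativeMonoidSolver *-commutativeMonoid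

    monomial-x : ∀ i j m e → monomial (suc i) j (m + e) ≈ (x ⊗ pow q m) ⊗ monomial i j e
    monomial-x i j m e = ≈-trans (*-congˡ (*-congˡ (pow-+ q m e)))
      (⊗-Solver.solve 5 (λ a b c d f → (a ∙ b) ∙ (c ∙ (d ∙ f)) ⊜ (a ∙ d) ∙ (b ∙ (c ∙ f)))
        ≈-refl x (pow x i) (pow y j) (pow q m) (pow q e))
      where open ⊗-Solver using (_⊜_) renaming (_⊕_ to _∙_)

    monomial-y : ∀ i j m e → monomial i (suc j) (m + e) ≈ (y ⊗ pow q m) ⊗ monomial i j e
    monomial-y i j m e = ≈-trans (*-congˡ (*-congˡ (pow-+ q m e)))
      (⊗-Solver.solve 5 (λ a b c d f → a ∙ ((b ∙ c) ∙ (d ∙ f)) ⊜ (b ∙ d) ∙ (a ∙ (c ∙ f)))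
        ≈-refl (pow x i) y (pow y j) (pow q m) (pow q e))
      where open ⊗-Solver using (_⊜_) renaming (_⊕_ to _∙_)

    X Y : ℕ → Carrier
    X n = x ⊗ pow q (suc n)
    Y n = y ⊗ pow q (n + n)

    weight : List ℕ → Carrier
    weight π = monomial (sStat π) (dStat π) (inv π)

    weight-≡ : ∀ ρ {rs e} → runs ρ ≡ rs → inv ρ ≡ e →
      weight ρ ≡ monomial (count (λ r → length r ≡ᵇ 1) rs) (count (λ r → length r ≡ᵇ 2) rs) e
    weight-≡ _ = cong₂ λ rs →
      monomial (count (λ r → length r ≡ᵇ 1) rs) (count (λ r → length r ≡ᵇ 2) rs)

    weight-max∷ : All (_< a) π → weight (a ∷ π) ≈ (x ⊗ pow q (length π)) ⊗ weight π
    weight-max∷ {a} {π} π<a = begin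
      weight (a ∷ π)
        ≡⟨ weight-≡ (a ∷ π) (runs-max∷ π<a) (inv-max∷ π<a) ⟩
      monomial (suc (sStat π)) (dStat π) (length π + inv π)
        ≈⟨ monomial-x (sStat π) (dStat π) (length π) (inv π) ⟩
      (x ⊗ pow q (length π)) ⊗ weight π ∎

    weight-block∷ : a < b → All (_< a) π →
                    weight (a ∷ b ∷ π) ≈ (y ⊗ pow q (length π + length π)) ⊗ weight π
    weight-block∷ {a} {b} {π} a<b π<a = begin
      weight (a ∷ b ∷ π)
        ≡⟨ weight-≡ (a ∷ b ∷ π) (runs-block∷ a<b (All.map (λ c<a → ℕ.<-trans c<a a<b) π<a))
                                (trans (inv-block∷ a<b π<a) (sym (ℕ.+-assoc (length π) (length π) (inv π)))) ⟩
      monomial (sStat π) (suc (dStat π)) ((length π + length π) + inv π)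
        ≈⟨ monomial-y (sStat π) (dStat π) (length π + length π) (inv π) ⟩
      (y ⊗ pow q (length π + length π)) ⊗ weight π ∎

    layeredSum : ℕ → Carrier
    layeredSum n = sumL weight (layered n)

    layeredSum-rec : ∀ n → layeredSum (suc (suc n)) ≈ X n ⊗ layeredSum (suc n) ⊕ Y n ⊗ layeredSum n
    layeredSum-rec n = begin
      sumL weight (layered (suc (suc n)))
        ≈⟨ sumL-++ weight (map (N ∷_) (layered (suc n))) _ ⟩
      sumL weight (map (N ∷_) (layered (suc n))) ⊕ sumL weight (map (λ π → suc n ∷ N ∷ π) (layered n))
        ≡⟨ cong₂ _⊕_ (sumL-map weight _ (layered (suc n))) (sumL-map weight _ (layered n)) ⟩
      sumL (λ π → weight (N ∷ π)) (layered (suc n)) ⊕ sumL (λ π → weight (suc n ∷ N ∷ π)) (layered n)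
        ≈⟨ +-cong (sumL-cong (layered (suc n)) max-step) (sumL-cong (layered n) block-step) ⟩
      sumL (λ π → X n ⊗ weight π) (layered (suc n)) ⊕ sumL (λ π → Y n ⊗ weight π) (layered n)
        ≈⟨ +-cong (sumL-⊗ (X n) weight (layered (suc n))) (sumL-⊗ (Y n) weight (layered n)) ⟩
      X n ⊗ layeredSum (suc n) ⊕ Y n ⊗ layeredSum n ∎
      where
      N = suc (suc n)
      max-step : ∀ {π} → π ∈ layered (suc n) → weight (N ∷ π) ≈ X n ⊗ weight π
      max-step π∈ = ≈-trans (weight-max∷ (All.map s≤s (entries≤ av)))
                            (*-congʳ (*-congˡ (≈-reflexive (cong (pow q) (length≡ av)))))
        where av = layered⇒avoider (suc n) π∈
      block-step : ∀ {π} → π ∈ layered n → weight (suc n ∷ N ∷ π) ≈ Y n ⊗ weight π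
      block-step π∈ = ≈-trans (weight-block∷ ℕ.≤-refl (All.map s≤s (entries≤ av)))
                              (*-congʳ (*-congˡ (≈-reflexive (cong (λ m → pow q (m + m)) (length≡ av)))))
        where av = layered⇒avoider n π∈

    -- The summand of RHS; the terms with 2k > n, which RHS omits, vanish.
    summand : ℕ → ℕ → Carrier
    summand n k = times ((n ∸ k) C k) (monomial (n ∸ 2 * k) k (n C 2 ∸ k))

    summand-vanishes : n < 2 * k → summand n k ≈ 0#
    summand-vanishes {n} {k} n<2k rewrite binomial-vanishes {n} {k} n<2k = ≈-refl

    summand-beyond : ∀ n → summand n (suc n) ≈ 0#
    summand-beyond n = summand-vanishes {n} {suc n} (ℕ.m≤m+n (suc n) (suc n + 0))

    monomial-X : 2 * j ≤ suc n →
      monomial (suc (suc n) ∸ 2 * j) j (suc (suc n) C 2 ∸ j)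
        ≈ X n ⊗ monomial (suc n ∸ 2 * j) j (suc n C 2 ∸ j)
    monomial-X {j} {n} 2j≤1+n rewrite x-exponent-X {j} {n} 2j≤1+n | q-exponent-X {j} {n} 2j≤1+n =
      monomial-x (suc n ∸ 2 * j) j (suc n) (suc n C 2 ∸ j)

    monomial-Y : 2 * k ≤ n →
      monomial (suc (suc n) ∸ 2 * suc k) (suc k) (suc (suc n) C 2 ∸ suc k)
        ≈ Y n ⊗ monomial (n ∸ 2 * k) k (n C 2 ∸ k)
    monomial-Y {k} {n} 2k≤n rewrite x-exponent-Y n k | q-exponent-Y {k} {n} 2k≤n =
      monomial-y (n ∸ 2 * k) k (n + n) (n C 2 ∸ k)

    -- The exponents obey the recurrence only when 2j ≤ n + 1 (∸ truncates); a coefficient m = 0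
    -- absorbs the other cases.
    scaled-X : ∀ m j → (0 < m → 2 * j ≤ suc n) →
      times m (monomial (suc (suc n) ∸ 2 * j) j (suc (suc n) C 2 ∸ j))
        ≈ X n ⊗ times m (monomial (suc n ∸ 2 * j) j (suc n C 2 ∸ j))
    scaled-X {n} m j bound = ≈-trans (times-cong-positive m (monomial-X {j} {n} ∘ bound)) (times-⊗ m (X n) _)

    scaled-Y : ∀ m k → (0 < m → 2 * k ≤ n) →
      times m (monomial (suc (suc n) ∸ 2 * suc k) (suc k) (suc (suc n) C 2 ∸ suc k))
        ≈ Y n ⊗ times m (monomial (n ∸ 2 * k) k (n C 2 ∸ k))
    scaled-Y {n} m k bound = ≈-trans (times-cong-positive m (monomial-Y {k} {n} ∘ bound)) (times-⊗ m (Y n) _)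

    summand-rec : ∀ n k → summand (suc (suc n)) (suc k) ≈ X n ⊗ summand (suc n) (suc k) ⊕ Y n ⊗ summand n k
    summand-rec n k = begin
      times ((suc n ∸ k) C suc k) M
        ≡⟨ cong (λ m → times m M) (binomial-pascal n k) ⟩
      times ((n ∸ k) C k + (n ∸ k) C suc k) M
        ≈⟨ times-+ ((n ∸ k) C k) ((n ∸ k) C suc k) M ⟩
      times ((n ∸ k) C k) M ⊕ times ((n ∸ k) C suc k) M
        ≈⟨ +-cong (scaled-Y _ k (binomial-positive⇒ {n} {k}))
                  (scaled-X _ (suc k) (binomial-positive⇒ {suc n} {suc k})) ⟩
      Y n ⊗ summand n k ⊕ X n ⊗ summand (suc n) (suc k)
        ≈⟨ +-comm _ _ ⟩
      X n ⊗ summand (suc n) (suc k) ⊕ Y n ⊗ summand n k ∎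
      where M = monomial (suc (suc n) ∸ 2 * suc k) (suc k) (suc (suc n) C 2 ∸ suc k)

    closedForm : ℕ → Carrier
    closedForm n = ∑[ k < suc n ] summand n (toℕ k)

    closedForm-rec : ∀ n → closedForm (suc (suc n)) ≈ X n ⊗ closedForm (suc n) ⊕ Y n ⊗ closedForm n
    closedForm-rec n = begin
      summand (suc (suc n)) 0 ⊕ ∑[ k < suc (suc n) ] summand (suc (suc n)) (suc (toℕ k))
        ≈⟨ +-cong (scaled-X {n} 1 0 λ _ → z≤n) (sum-cong-≋ {suc (suc n)} (summand-rec n ∘ toℕ)) ⟩
      X n ⊗ summand (suc n) 0 ⊕ ∑[ k < suc (suc n) ] (X n ⊗ t₁ k ⊕ Y n ⊗ t₀ k)
        ≈⟨ +-congˡ (∑-distrib-+ (λ k → X n ⊗ t₁ k) (λ k → Y n ⊗ t₀ k)) ⟩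
      X n ⊗ summand (suc n) 0 ⊕ (∑[ k < suc (suc n) ] (X n ⊗ t₁ k) ⊕ ∑[ k < suc (suc n) ] (Y n ⊗ t₀ k))
        ≈⟨ +-congˡ (+-cong (*-distribˡ-sum (X n) t₁) (*-distribˡ-sum (Y n) t₀)) ⟨
      X n ⊗ summand (suc n) 0 ⊕ (X n ⊗ ∑[ k < suc (suc n) ] t₁ k ⊕ Y n ⊗ ∑[ k < suc (suc n) ] t₀ k)
        ≈⟨ +-assoc _ _ _ ⟨
      (X n ⊗ summand (suc n) 0 ⊕ X n ⊗ ∑[ k < suc (suc n) ] t₁ k) ⊕ Y n ⊗ ∑[ k < suc (suc n) ] t₀ k
        ≈⟨ +-congʳ (distribˡ (X n) _ _) ⟨
      X n ⊗ ∑[ k < suc (suc (suc n)) ] summand (suc n) (toℕ k) ⊕ Y n ⊗ ∑[ k < suc (suc n) ] t₀ k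
        ≈⟨ +-cong (*-congˡ (∑-init (summand (suc n)) (suc (suc n)) (summand-beyond (suc n))))
                  (*-congˡ (∑-init (summand n) (suc n) (summand-beyond n))) ⟩
      X n ⊗ closedForm (suc n) ⊕ Y n ⊗ closedForm n ∎
      where
      t₁ t₀ : Fin (suc (suc n)) → Carrier
      t₁ k = summand (suc n) (suc (toℕ k))
      t₀ k = summand n (toℕ k)

    layeredSum≈closedForm : ∀ n → layeredSum n ≈ closedForm n
    layeredSum≈closedForm =
      recurrence-unique X Y layeredSum closedForm base₀ base₁ layeredSum-rec closedForm-rec
      where
      base₀ : layeredSum 0 ≈ closedForm 0
      base₀ = +-congʳ (≈-sym (+-identityʳ _))
      base₁ : layeredSum 1 ≈ closedForm 1
      base₁ = ≈-sym (≈-trans (+-congˡ (+-identityʳ 0#)) (+-identityʳ _))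

    RHS≈closedForm : ∀ n → RHS n x y q ≈ closedForm n
    RHS≈closedForm n = begin
      sumL (summand n) (filterᵇ (λ k → 2 * k ≤ᵇ n) (upTo (suc n)))
        ≈⟨ sumL-filter (summand n) _ (upTo (suc n)) vanishing ⟩
      sumL (summand n) (upTo (suc n))
        ≡⟨ sumL-upTo (summand n) (suc n) ⟩
      closedForm n ∎
      where
      vanishing : ∀ k → (2 * k ≤ᵇ n) ≡ false → summand n k ≈ 0#
      vanishing k 2k≰ᵇn = summand-vanishes {n} {k} (ℕ.≰⇒> λ 2k≤n → subst T 2k≰ᵇn (ℕ.≤⇒≤ᵇ 2k≤n))

theorem4p2 : {c ℓ : Level} (R : CommutativeSemiring c ℓ) (n : ℕ)
             (x y q : CommutativeSemiring.Carrier R) →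
             CommutativeSemiring._≈_ R (Eval.F R n x y q) (Eval.RHS R n x y q)
theorem4p2 R n x y q = begin
  Eval.F R n x y q   ≈⟨ sumL-↭ R (weight R x y q) (avoiders↭layered n) ⟩
  layeredSum R x y q n        ≈⟨ layeredSum≈closedForm R x y q n ⟩
  closedForm R x y q n        ≈⟨ RHS≈closedForm R x y q n ⟨
  Eval.RHS R n x y q ∎
  where open import Relation.Binary.Reasoning.Setoid (CommutativeSemiring.setoid R)
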